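{- For every integer $n\geq 3$, $\gamma_2(G_{4,n})=\left\lceil \frac{7n+3}{4}\right\rceil$.
   Context: For a graph $G$, a set $D\subseteq V(G)$ is a $2$-dominating set if every vertex not in $D$ has at least $2$ neighbours in $D$. The $2$-domination number $\gamma_2(G)$ is the minimum cardinality of a $2$-dominating set of $G$. The grid graph $G_{m,n}=P_m\times P_n$ has vertex set $[m]\times[n]$ (where $[k]=\{1,\dots,k\}$), with $(i,j)$ and $(i',j')$ adjacent iff $|i-i'|+|j-j'|=1$. -}

module Defs where

open import Data.Nat using (ℕ; zero; suc; _+_; _*_; _≤_)
open import Data.Nat.DivMod using (_/_)
open import Data.Fin using (Fin; toℕ)
open import Data.Bool using (Bool; true; false; T) renaming (_≟_ to _≟ᵇ_)
open import Data.List using (List; map; length; filter; allFin)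
open import Data.Nat.ListAction using (sum)
open import Data.Product using (_×_; _,_; ∃; ∃-syntax; Σ)
open import Data.Sum using (_⊎_)
open import Relation.Binary.PropositionalEquality using (_≡_; _≢_)
open import Relation.Nullary using (¬_)

Vertex : ℕ → ℕ → Set
Vertex m n = Fin m × Fin n

Adj1 : ℕ → ℕ → Set
Adj1 a b = (suc a ≡ b) ⊎ (suc b ≡ a)

GridAdj : ∀ {m n} → Vertex m n → Vertex m n → Set
GridAdj (i , j) (i' , j') =
  (i ≡ i' × Adj1 (toℕ j) (toℕ j')) ⊎ (j ≡ j' × Adj1 (toℕ i) (toℕ i'))

VSet : ℕ → ℕ → Set
VSet m n = Vertex m n → Bool

_∈D_ : ∀ {m n} → Vertex m n → VSet m n → Set
v ∈D D = T (D v)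

card : ∀ {m n} → VSet m n → ℕ
card {m} {n} D =
  sum (map (λ i → length (filter (λ j → D (i , j) ≟ᵇ true) (allFin n))) (allFin m))

IsTwoDominating : ∀ {m n} → VSet m n → Set
IsTwoDominating {m} {n} D =
  (v : Vertex m n) → ¬ (v ∈D D) →
  Σ (Vertex m n) λ u → Σ (Vertex m n) λ w →
    u ≢ w × GridAdj v u × GridAdj v w × u ∈D D × w ∈D D

TwoDominationNumber : ℕ → ℕ → ℕ → Set
TwoDominationNumber m n k =
  (Σ (VSet m n) λ D → IsTwoDominating D × card D ≡ k) ×
  ((D : VSet m n) → IsTwoDominating D → k ≤ card D)

ceil4 : ℕ → ℕ
ceil4 a = (a + 3) / 4

module Submission where

-- The upper bound is an explicit pattern: after three fixed columns it repeats an 8-column block containing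
-- 14 vertices and ends with one of eight tails chosen by n mod 8.
--
-- For the lower bound, a vertex set is read as its sequence of columns. It is 2-dominating exactly when every
-- column, together with its two neighbouring columns (empty beyond the ends), satisfies a local condition.
-- A potential φ on pairs of consecutive columns, verified by exhaustive computation over all column triples,
-- satisfies φ(x, q) + 7 ≤ φ(p, x) + 4|q| for every locally valid triple p, x, q. Telescoping along the
-- columns, with separate checks for the first three columns and for the last pair, gives 7n + 3 ≤ 4|D|.

open import Data.Bool using (Bool; true; false; T; not; _∧_; _∨_) renaming (_≟_ to _≟ᵇ_)
open import Data.Bool.Properties using (T?; T-∧; T-≡)
open import Data.Empty using (⊥-elim)
open import Data.Unit using (tt)
open import Data.Fin using (Fin; zero; suc; toℕ; fromℕ<; _↑ˡ_; _↑ʳ_)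
open import Data.Fin.Properties using (toℕ-injective; toℕ<n; toℕ-fromℕ<; fromℕ<-toℕ; all?; any?; _≟_)
open import Data.List as List using (List; []; _∷_; length; filter; allFin)
open import Data.List.Properties using (map-cong; map-tabulate)
open import Data.Nat using (ℕ; zero; suc; _+_; _*_; _^_; _≤_; _<_; _≤ᵇ_; _≡ᵇ_; z≤n; s≤s)
open import Data.Nat.DivMod using (_/_; _%_; +-distrib-/-∣ʳ; +-distrib-/-∣ˡ; /-monoˡ-≤; m*n/n≡m)
open import Data.Nat.Divisibility using (divides-refl)
open import Data.Nat.ListAction using () renaming (sum to sumᴸ)
open import Data.Nat.Properties hiding (_≟_)
open import Data.Nat.Solver using (module +-*-Solver)
open import Data.Product using (Σ; ∃; _×_; _,_; proj₁; proj₂)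
open import Data.Sum using (_⊎_; inj₁; inj₂)
open import Data.Vec using (Vec; []; _∷_; lookup; tabulate; _++_)
open import Data.Vec.Properties using (lookup∘tabulate; tabulate∘lookup; tabulate-cong)
open import Function using (_∘_; Equivalence)
open import Relation.Binary.PropositionalEquality
open import Relation.Nullary using (Dec; yes; no; ¬?; contradiction)
open import Relation.Nullary.Decidable using (isYes; toWitness; _×-dec_; _⊎-dec_)

open import Algebra.Properties.CommutativeMonoid.Sum +-0-commutativeMonoid using (sum-syntax; ∑-comm; sum-cong-≗)
open import Algebra.Properties.CommutativeSemigroup +-commutativeSemigroup using (xy∙z≈xz∙y)
open +-*-Solver using (solve; _:+_; _:*_; con; _:=_)

open import Defs

oneIf : Bool → ℕ
oneIf false = 0
oneIf true  = 1

length-filter-≟true : {A : Set} (g : A → Bool) (xs : List A) →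
  length (filter (λ x → g x ≟ᵇ true) xs) ≡ sumᴸ (List.map (oneIf ∘ g) xs)
length-filter-≟true g [] = refl
length-filter-≟true g (x ∷ xs) with g x
... | true  = cong suc (length-filter-≟true g xs)
... | false = length-filter-≟true g xs

sumᴸ-map-allFin : ∀ {n} (f : Fin n → ℕ) → sumᴸ (List.map f (allFin n)) ≡ ∑[ i < n ] f i
sumᴸ-map-allFin f = trans (cong sumᴸ (map-tabulate (λ i → i) f)) (sumᴸ-tabulate f)
  where
  sumᴸ-tabulate : ∀ {n} (f : Fin n → ℕ) → sumᴸ (List.tabulate f) ≡ ∑[ i < n ] f i
  sumᴸ-tabulate {zero}  f = refl
  sumᴸ-tabulate {suc n} f = cong (f zero +_) (sumᴸ-tabulate (f ∘ suc))

card≡∑∑ : ∀ {m n} (D : VSet m n) → card D ≡ ∑[ j < n ] ∑[ i < m ] oneIf (D (i , j))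
card≡∑∑ {m} {n} D = begin
  card D
    ≡⟨ cong sumᴸ (map-cong row (allFin m)) ⟩
  sumᴸ (List.map (λ i → ∑[ j < n ] oneIf (D (i , j))) (allFin m))
    ≡⟨ sumᴸ-map-allFin (λ i → ∑[ j < n ] oneIf (D (i , j))) ⟩
  ∑[ i < m ] ∑[ j < n ] oneIf (D (i , j))
    ≡⟨ ∑-comm (λ i j → oneIf (D (i , j))) ⟩
  ∑[ j < n ] ∑[ i < m ] oneIf (D (i , j)) ∎
  where
  open ≡-Reasoning
  row : ∀ i → length (filter (λ j → D (i , j) ≟ᵇ true) (allFin n)) ≡ ∑[ j < n ] oneIf (D (i , j))
  row i = trans (length-filter-≟true (λ j → D (i , j)) (allFin n)) (sumᴸ-map-allFin (λ j → oneIf (D (i , j))))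

-- Directions are the elements of Fin 4, so that the library's any? decides TwoAmong.
Dir : Set
Dir = Fin 4

pattern left  = zero
pattern right = suc zero
pattern up    = suc (suc zero)
pattern down  = suc (suc (suc zero))

TwoAmong : (Dir → Bool) → Set
TwoAmong b = ∃ λ d₁ → ∃ λ d₂ → d₁ ≢ d₂ × T (b d₁) × T (b d₂)

Dominated : Bool → (Dir → Bool) → Set
Dominated self b = T self ⊎ TwoAmong b

dominated? : ∀ self b → Dec (Dominated self b)
dominated? self b =
  T? self ⊎-dec any? λ d₁ → any? λ d₂ → ¬? (d₁ ≟ d₂) ×-dec T? (b d₁) ×-dec T? (b d₂)

Dominated-cong : ∀ {s s′ b b′} → s ≡ s′ → b ≗ b′ → Dominated s b → Dominated s′ b′
Dominated-cong refl b≗b′ (inj₁ t) = inj₁ t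
Dominated-cong refl b≗b′ (inj₂ (d₁ , d₂ , d₁≢d₂ , t₁ , t₂)) =
  inj₂ (d₁ , d₂ , d₁≢d₂ , subst T (b≗b′ d₁) t₁ , subst T (b≗b′ d₂) t₂)

Towards : ∀ {m n} → Dir → Vertex m n → Vertex m n → Set
Towards left  (i , j) (i′ , j′) = i ≡ i′ × suc (toℕ j′) ≡ toℕ j
Towards right (i , j) (i′ , j′) = i ≡ i′ × suc (toℕ j) ≡ toℕ j′
Towards up    (i , j) (i′ , j′) = j ≡ j′ × suc (toℕ i′) ≡ toℕ i
Towards down  (i , j) (i′ , j′) = j ≡ j′ × suc (toℕ i) ≡ toℕ i′

module _ {m n : ℕ} where

  GridAdj⇒Towards : {v u : Vertex m n} → GridAdj v u → ∃ λ d → Towards d v u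
  GridAdj⇒Towards (inj₁ (i≡i′ , inj₁ s)) = right , i≡i′ , s
  GridAdj⇒Towards (inj₁ (i≡i′ , inj₂ s)) = left  , i≡i′ , s
  GridAdj⇒Towards (inj₂ (j≡j′ , inj₁ s)) = down  , j≡j′ , s
  GridAdj⇒Towards (inj₂ (j≡j′ , inj₂ s)) = up    , j≡j′ , s

  Towards⇒GridAdj : ∀ d {v u : Vertex m n} → Towards d v u → GridAdj v u
  Towards⇒GridAdj left  (i≡i′ , s) = inj₁ (i≡i′ , inj₂ s)
  Towards⇒GridAdj right (i≡i′ , s) = inj₁ (i≡i′ , inj₁ s)
  Towards⇒GridAdj up    (j≡j′ , s) = inj₂ (j≡j′ , inj₂ s)
  Towards⇒GridAdj down  (j≡j′ , s) = inj₂ (j≡j′ , inj₁ s)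

  Towards-injective : ∀ d {v u w : Vertex m n} → Towards d v u → Towards d v w → u ≡ w
  Towards-injective left  {i , _} (refl , s) (refl , s′) = cong (i ,_) (toℕ-injective (suc-injective (trans s (sym s′))))
  Towards-injective right {i , _} (refl , s) (refl , s′) = cong (i ,_) (toℕ-injective (trans (sym s) s′))
  Towards-injective up    {_ , j} (refl , s) (refl , s′) = cong (_, j) (toℕ-injective (suc-injective (trans s (sym s′))))
  Towards-injective down  {_ , j} (refl , s) (refl , s′) = cong (_, j) (toℕ-injective (trans (sym s) s′))

  private
    2+n≢n : ∀ {k : ℕ} → suc (suc k) ≢ k
    2+n≢n {suc k} eq = 2+n≢n (suc-injective eq)

  Towards-unique : ∀ d d′ {v u : Vertex m n} → Towards d v u → Towards d′ v u → d ≡ d′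
  Towards-unique left  left  _          _          = refl
  Towards-unique right right _          _          = refl
  Towards-unique up    up    _          _          = refl
  Towards-unique down  down  _          _          = refl
  Towards-unique left  right (_ , s)    (_ , s′)   = ⊥-elim (2+n≢n (trans (cong suc s′) s))
  Towards-unique right left  (_ , s)    (_ , s′)   = ⊥-elim (2+n≢n (trans (cong suc s) s′))
  Towards-unique up    down  (_ , s)    (_ , s′)   = ⊥-elim (2+n≢n (trans (cong suc s′) s))
  Towards-unique down  up    (_ , s)    (_ , s′)   = ⊥-elim (2+n≢n (trans (cong suc s) s′))
  Towards-unique left  up    (refl , s) (refl , _) = ⊥-elim (1+n≢n s)
  Towards-unique left  down  (refl , s) (refl , _) = ⊥-elim (1+n≢n s)
  Towards-unique right up    (refl , s) (refl , _) = ⊥-elim (1+n≢n s)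
  Towards-unique right down  (refl , s) (refl , _) = ⊥-elim (1+n≢n s)
  Towards-unique up    left  (refl , _) (refl , s) = ⊥-elim (1+n≢n s)
  Towards-unique up    right (refl , _) (refl , s) = ⊥-elim (1+n≢n s)
  Towards-unique down  left  (refl , _) (refl , s) = ⊥-elim (1+n≢n s)
  Towards-unique down  right (refl , _) (refl , s) = ⊥-elim (1+n≢n s)

before : {A : Set} → A → (ℕ → A) → ℕ → A
before x₀ s zero    = x₀
before x₀ s (suc k) = s k

before-cong : {A : Set} {x₀ : A} {s s′ : ℕ → A} → s ≗ s′ → before x₀ s ≗ before x₀ s′
before-cong s≗s′ zero    = refl
before-cong s≗s′ (suc k) = s≗s′ k

before-true : {s : ℕ → Bool} {a : ℕ} → T (before false s a) → ∃ λ k → suc k ≡ a × T (s k)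
before-true {a = suc k} t = k , refl , t

module _ {m n : ℕ} (D : VSet m n) where

  extend : ℕ → ℕ → Bool
  extend a b with a <? m | b <? n
  ... | yes a<m | yes b<n = D (fromℕ< a<m , fromℕ< b<n)
  ... | _       | _       = false

  extend-toℕ : ∀ i j → extend (toℕ i) (toℕ j) ≡ D (i , j)
  extend-toℕ i j with toℕ i <? m | toℕ j <? n
  ... | yes i<m | yes j<n = cong₂ (λ i j → D (i , j)) (fromℕ<-toℕ i i<m) (fromℕ<-toℕ j j<n)
  ... | no i≮m  | _       = contradiction (toℕ<n i) i≮m
  ... | yes _   | no j≮n  = contradiction (toℕ<n j) j≮n

  extend-true : ∀ a b → T (extend a b) → ∃ λ v → toℕ (proj₁ v) ≡ a × toℕ (proj₂ v) ≡ b × T (D v)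
  extend-true a b t with a <? m | b <? n
  ... | yes a<m | yes b<n = (fromℕ< a<m , fromℕ< b<n) , toℕ-fromℕ< a<m , toℕ-fromℕ< b<n , t
  ... | no _    | _       = ⊥-elim t
  ... | yes _   | no _    = ⊥-elim t

  extend-beyond-rows : ∀ {a} b → m ≤ a → extend a b ≡ false
  extend-beyond-rows {a} b m≤a with a <? m
  ... | yes a<m = contradiction a<m (≤⇒≯ m≤a)
  ... | no _    = refl

  extend-beyond-columns : ∀ a {b} → n ≤ b → extend a b ≡ false
  extend-beyond-columns a {b} n≤b with a <? m | b <? n
  ... | yes _ | yes b<n = contradiction b<n (≤⇒≯ n≤b)
  ... | yes _ | no _    = refl
  ... | no _  | _       = refl

  around : Vertex m n → Dir → Bool
  around (i , j) left  = before false (extend (toℕ i)) (toℕ j)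
  around (i , j) right = extend (toℕ i) (suc (toℕ j))
  around (i , j) up    = before false (λ a → extend a (toℕ j)) (toℕ i)
  around (i , j) down  = extend (suc (toℕ i)) (toℕ j)

  Towards⇒around : ∀ d {v u} → Towards d v u → T (D u) → T (around v d)
  Towards⇒around left  {i , j} {_ , j′} (refl , s) t rewrite sym s | extend-toℕ i j′ = t
  Towards⇒around right {i , j} {_ , j′} (refl , s) t rewrite s | extend-toℕ i j′ = t
  Towards⇒around up    {i , j} {i′ , _} (refl , s) t rewrite sym s | extend-toℕ i′ j = t
  Towards⇒around down  {i , j} {i′ , _} (refl , s) t rewrite s | extend-toℕ i′ j = t

  around⇒Towards : ∀ d {v} → T (around v d) → ∃ λ u → Towards d v u × T (D u)
  around⇒Towards left {i , j} t =
    let k , k+1≡j , t′ = before-true t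
        u , i′≡i , j′≡k , tu = extend-true (toℕ i) k t′
    in u , (toℕ-injective (sym i′≡i) , trans (cong suc j′≡k) k+1≡j) , tu
  around⇒Towards right {i , j} t =
    let u , i′≡i , j′≡j+1 , tu = extend-true (toℕ i) (suc (toℕ j)) t
    in u , (toℕ-injective (sym i′≡i) , sym j′≡j+1) , tu
  around⇒Towards up {i , j} t =
    let k , k+1≡i , t′ = before-true t
        u , i′≡k , j′≡j , tu = extend-true k (toℕ j) t′
    in u , (toℕ-injective (sym j′≡j) , trans (cong suc i′≡k) k+1≡i) , tu
  around⇒Towards down {i , j} t =
    let u , i′≡i+1 , j′≡j , tu = extend-true (suc (toℕ i)) (toℕ j) t
    in u , (toℕ-injective (sym j′≡j) , sym i′≡i+1) , tu

  LocallyDominated : Set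
  LocallyDominated = ∀ v → Dominated (D v) (around v)

  twoDominating⇒local : IsTwoDominating D → LocallyDominated
  twoDominating⇒local dom v with T? (D v)
  ... | yes t = inj₁ t
  ... | no ¬t =
    let u , w , u≢w , adj-u , adj-w , tu , tw = dom v ¬t
        d₁ , to-u = GridAdj⇒Towards adj-u
        d₂ , to-w = GridAdj⇒Towards adj-w
        d₁≢d₂ = λ d₁≡d₂ → u≢w (Towards-injective d₁ to-u (subst (λ d → Towards d v w) (sym d₁≡d₂) to-w))
    in inj₂ (d₁ , d₂ , d₁≢d₂ , Towards⇒around d₁ to-u tu , Towards⇒around d₂ to-w tw)

  local⇒twoDominating : LocallyDominated → IsTwoDominating D
  local⇒twoDominating loc v ¬t with loc v
  ... | inj₁ t = contradiction t ¬t
  ... | inj₂ (d₁ , d₂ , d₁≢d₂ , t₁ , t₂) =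
    let u , to-u , tu = around⇒Towards d₁ t₁
        w , to-w , tw = around⇒Towards d₂ t₂
        u≢w = λ u≡w → d₁≢d₂ (Towards-unique d₁ d₂ to-u (subst (Towards d₂ v) (sym u≡w) to-w))
    in u , w , u≢w , Towards⇒GridAdj d₁ to-u , Towards⇒GridAdj d₂ to-w , tu , tw

lookupOr : {A : Set} {k : ℕ} → A → Vec A k → ℕ → A
lookupOr x₀ []       _       = x₀
lookupOr x₀ (x ∷ xs) zero    = x
lookupOr x₀ (x ∷ xs) (suc a) = lookupOr x₀ xs a

lookupOr-toℕ : {A : Set} {k : ℕ} {x₀ : A} (xs : Vec A k) (j : Fin k) → lookupOr x₀ xs (toℕ j) ≡ lookup xs j
lookupOr-toℕ (x ∷ xs) zero    = refl
lookupOr-toℕ (x ∷ xs) (suc j) = lookupOr-toℕ xs j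

lookupOr-beyond : {A : Set} {k : ℕ} {x₀ : A} (xs : Vec A k) {a : ℕ} → k ≤ a → lookupOr x₀ xs a ≡ x₀
lookupOr-beyond []       _         = refl
lookupOr-beyond (x ∷ xs) (s≤s k≤a) = lookupOr-beyond xs k≤a

lookupOr-tabulate : {A : Set} {x₀ : A} (k : ℕ) (g : ℕ → A) → (∀ a → k ≤ a → g a ≡ x₀) →
                    ∀ a → lookupOr x₀ (tabulate {n = k} (g ∘ toℕ)) a ≡ g a
lookupOr-tabulate zero    g beyond a       = sym (beyond a z≤n)
lookupOr-tabulate (suc k) g beyond zero    = refl
lookupOr-tabulate (suc k) g beyond (suc a) =
  lookupOr-tabulate k (g ∘ suc) (λ a k≤a → beyond (suc a) (s≤s k≤a)) a

Column : ℕ → Set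
Column m = Vec Bool m

empty : ∀ {m} → Column m
empty = tabulate λ _ → false

weight : ∀ {m} → Column m → ℕ
weight {m} x = ∑[ i < m ] oneIf (lookup x i)

aroundRow : ∀ {m} → ℕ → (p x q : Column m) → Dir → Bool
aroundRow a p x q left  = lookupOr false p a
aroundRow a p x q right = lookupOr false q a
aroundRow a p x q up    = before false (lookupOr false x) a
aroundRow a p x q down  = lookupOr false x (suc a)

RowOK : ∀ {m} → Fin m → (p x q : Column m) → Set
RowOK i p x q = Dominated (lookup x i) (aroundRow (toℕ i) p x q)

ColumnOK : ∀ {m} → (p x q : Column m) → Set
ColumnOK p x q = ∀ i → RowOK i p x q

columnOK? : ∀ {m} (p x q : Column m) → Dec (ColumnOK p x q)
columnOK? p x q = all? λ i → dominated? _ _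

module _ {m n : ℕ} (D : VSet m n) where

  column : ℕ → Column m
  column b = tabulate λ i → extend D (toℕ i) b

  lookupOr-column : ∀ a b → lookupOr false (column b) a ≡ extend D a b
  lookupOr-column a b = lookupOr-tabulate m (λ a → extend D a b) (λ a m≤a → extend-beyond-rows D b m≤a) a

  lookup-column : ∀ i j → lookup (column (toℕ j)) i ≡ D (i , j)
  lookup-column i j = trans (lookup∘tabulate _ i) (extend-toℕ D i j)

  column-beyond : ∀ {b} → n ≤ b → column b ≡ empty
  column-beyond n≤b = tabulate-cong λ i → extend-beyond-columns D (toℕ i) n≤b

  around≗aroundRow : ∀ i j →
    around D (i , j) ≗ aroundRow (toℕ i) (before empty column (toℕ j)) (column (toℕ j)) (column (suc (toℕ j)))
  around≗aroundRow i j left  = left-column (toℕ j)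
    where
    left-column : ∀ b → before false (extend D (toℕ i)) b ≡ lookupOr false (before empty column b) (toℕ i)
    left-column zero    = sym (lookupOr-tabulate m (λ _ → false) (λ _ _ → refl) (toℕ i))
    left-column (suc b) = sym (lookupOr-column (toℕ i) b)
  around≗aroundRow i j right = sym (lookupOr-column (toℕ i) (suc (toℕ j)))
  around≗aroundRow i j up    = sym (before-cong (λ a → lookupOr-column a (toℕ j)) (toℕ i))
  around≗aroundRow i j down  = sym (lookupOr-column (suc (toℕ i)) (toℕ j))

  local⇒rowOK : ∀ i j → Dominated (D (i , j)) (around D (i , j)) →
                RowOK i (before empty column (toℕ j)) (column (toℕ j)) (column (suc (toℕ j)))
  local⇒rowOK i j = Dominated-cong (sym (lookup-column i j)) (around≗aroundRow i j)

  rowOK⇒local : ∀ i j → RowOK i (before empty column (toℕ j)) (column (toℕ j)) (column (suc (toℕ j))) →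
                Dominated (D (i , j)) (around D (i , j))
  rowOK⇒local i j = Dominated-cong (lookup-column i j) (sym ∘ around≗aroundRow i j)

  card≡∑weight : card D ≡ ∑[ j < n ] weight (column (toℕ j))
  card≡∑weight = trans (card≡∑∑ D)
    (sum-cong-≗ λ j → sum-cong-≗ λ i → cong oneIf (sym (lookup-column i j)))

module Sequences {A : Set} (Ok : A → A → A → Set) where

  -- p stands in for s (-1); s n enters only as the right neighbour of the last column s (n - 1).
  ValidFrom : A → (ℕ → A) → ℕ → Set
  ValidFrom p s n = ∀ k → k < n → Ok (before p s k) (s k) (s (suc k))

  valid-∷ : ∀ {p s n} → Ok p (s 0) (s 1) → ValidFrom (s 0) (s ∘ suc) n → ValidFrom p s (suc n)
  valid-∷ ok V zero          _         = ok
  valid-∷ ok V (suc zero)    (s≤s k<n) = V zero k<n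
  valid-∷ ok V (suc (suc k)) (s≤s k<n) = V (suc k) k<n

  valid-head : ∀ {p s n} → ValidFrom p s (suc n) → Ok p (s 0) (s 1)
  valid-head V = V zero (s≤s z≤n)

  valid-tail : ∀ {p s n} → ValidFrom p s (suc n) → ValidFrom (s 0) (s ∘ suc) n
  valid-tail V zero    k<n = V 1 (s≤s k<n)
  valid-tail V (suc k) k<n = V (suc (suc k)) (s≤s k<n)

  valid-cong : ∀ {p s s′ n} → s ≗ s′ → ValidFrom p s n → ValidFrom p s′ n
  valid-cong s≗s′ V k k<n =
    subst (λ z → Ok z _ _) (before-cong s≗s′ k) (subst₂ (Ok _) (s≗s′ k) (s≗s′ (suc k)) (V k k<n))

  module Checked (Ok? : ∀ p x q → Dec (Ok p x q)) (e : A) where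

    chainᵇ : ∀ {k} → A → Vec A (suc k) → Bool
    chainᵇ p (x ∷ [])     = isYes (Ok? p x e)
    chainᵇ p (x ∷ y ∷ ys) = isYes (Ok? p x y) ∧ chainᵇ x (y ∷ ys)

    chainᵇ-sound : ∀ {k p} (xs : Vec A (suc k)) → T (chainᵇ p xs) → ValidFrom p (lookupOr e xs) (suc k)
    chainᵇ-sound (x ∷ [])     t = valid-∷ (toWitness t) λ _ ()
    chainᵇ-sound (x ∷ y ∷ ys) t =
      let t₁ , t₂ = Equivalence.to T-∧ t in valid-∷ (toWitness t₁) (chainᵇ-sound (y ∷ ys) t₂)

module _ {m n : ℕ} (D : VSet m n) where

  open Sequences (ColumnOK {m})

  twoDominating⇒valid : IsTwoDominating D → ValidFrom empty (column D) n
  twoDominating⇒valid dom k k<n i =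
    subst (λ b → RowOK i (before empty (column D) b) (column D b) (column D (suc b))) (toℕ-fromℕ< k<n)
      (local⇒rowOK D i j (twoDominating⇒local D dom (i , j)))
    where
    j : Fin n
    j = fromℕ< k<n

  valid⇒twoDominating : ValidFrom empty (column D) n → IsTwoDominating D
  valid⇒twoDominating V = local⇒twoDominating D λ (i , j) → rowOK⇒local D i j (V (toℕ j) (toℕ<n j) i)

module PotentialBound {A : Set} (Ok : A → A → A → Set) (e : A) (w : A → ℕ) (φ : A → A → ℕ) (a b c d : ℕ)
  (step : ∀ {p x q} → Ok p x q → φ x q + a ≤ φ p x + b * w q)
  (final : ∀ {p x} → Ok p x e → c ≤ φ p x)
  (initial : ∀ {x₀ x₁ x₂} → Ok e x₀ x₁ → Ok x₀ x₁ x₂ → φ x₁ x₂ + 3 * a ≤ b * (w x₀ + w x₁ + w x₂) + d)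
  where

  open Sequences Ok
  open ≤-Reasoning

  tail-bound : ∀ r {p s} → ValidFrom p s (suc r) → s (suc r) ≡ e →
               a * r + c ≤ φ p (s 0) + b * ∑[ t < r ] w (s (suc (toℕ t)))
  tail-bound zero {p} {s} V s₁≡e = begin
    a * 0 + c          ≡⟨ cong (_+ c) (*-zeroʳ a) ⟩
    c                  ≤⟨ final (subst (Ok p (s 0)) s₁≡e (valid-head V)) ⟩
    φ p (s 0)          ≡⟨ solve 2 (λ x y → x := x :+ y :* con 0) refl (φ p (s 0)) b ⟩
    φ p (s 0) + b * 0  ∎
  tail-bound (suc r) {p} {s} V sₙ≡e = begin
    a * suc r + c                          ≡⟨ solve 3 (λ a r c → a :* (con 1 :+ r) :+ c := a :* r :+ c :+ a) refl a r c ⟩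
    a * r + c + a                          ≤⟨ +-monoˡ-≤ a (tail-bound r (valid-tail V) sₙ≡e) ⟩
    φ (s 0) (s 1) + b * rest + a           ≡⟨ xy∙z≈xz∙y (φ (s 0) (s 1)) (b * rest) a ⟩
    φ (s 0) (s 1) + a + b * rest           ≤⟨ +-monoˡ-≤ (b * rest) (step (valid-head V)) ⟩
    φ p (s 0) + b * w (s 1) + b * rest     ≡⟨ +-assoc (φ p (s 0)) (b * w (s 1)) (b * rest) ⟩
    φ p (s 0) + (b * w (s 1) + b * rest)   ≡⟨ cong (φ p (s 0) +_) (*-distribˡ-+ b (w (s 1)) rest) ⟨
    φ p (s 0) + b * (w (s 1) + rest)       ∎
    where
    rest : ℕ
    rest = ∑[ t < r ] w (s (2 + toℕ t))

  bound : ∀ r {s} → ValidFrom e s (3 + r) → s (3 + r) ≡ e →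
          a * (3 + r) + c ≤ b * ∑[ t < 3 + r ] w (s (toℕ t)) + d
  bound r {s} V sₙ≡e = begin
    a * (3 + r) + c                                   ≡⟨ solve 3 (λ a r c → a :* (con 3 :+ r) :+ c := a :* r :+ c :+ con 3 :* a) refl a r c ⟩
    a * r + c + 3 * a                                 ≤⟨ +-monoˡ-≤ (3 * a) (tail-bound r (valid-tail (valid-tail V)) sₙ≡e) ⟩
    φ (s 1) (s 2) + b * rest + 3 * a                  ≡⟨ xy∙z≈xz∙y (φ (s 1) (s 2)) (b * rest) (3 * a) ⟩
    φ (s 1) (s 2) + 3 * a + b * rest                  ≤⟨ +-monoˡ-≤ (b * rest) (initial (valid-head V) (valid-head (valid-tail V))) ⟩
    b * (w (s 0) + w (s 1) + w (s 2)) + d + b * rest  ≡⟨ solve 6 (λ b w₀ w₁ w₂ σ d → b :* (w₀ :+ w₁ :+ w₂) :+ d :+ b :* σ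
                                                                          := b :* (w₀ :+ (w₁ :+ (w₂ :+ σ))) :+ d)
                                                                 refl b (w (s 0)) (w (s 1)) (w (s 2)) rest d ⟩
    b * (w (s 0) + (w (s 1) + (w (s 2) + rest))) + d  ∎
    where
    rest : ℕ
    rest = ∑[ t < r ] w (s (3 + toℕ t))

allColumns : ∀ {m} → (Column m → Bool) → Bool
allColumns {zero}  f = f []
allColumns {suc m} f = allColumns (f ∘ (false ∷_)) ∧ allColumns (f ∘ (true ∷_))

allColumns-sound : ∀ {m} {f : Column m → Bool} → T (allColumns f) → ∀ x → T (f x)
allColumns-sound {zero}  t []          = t
allColumns-sound {suc m} t (false ∷ x) = allColumns-sound (proj₁ (Equivalence.to T-∧ t)) x
allColumns-sound {suc m} t (true ∷ x)  = allColumns-sound (proj₂ (Equivalence.to T-∧ t)) x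

T-∨-not : ∀ {A : Set} (A? : Dec A) {b} → T (b ∨ not (isYes A?)) → A → T b
T-∨-not (yes _) {true} t _ = t
T-∨-not (no ¬a)        t a = contradiction a ¬a

module _ {m : ℕ} where

  checkPairs : {A : Column m → Column m → Set} → (∀ p x → Dec (A p x)) → (Column m → Column m → Bool) → Bool
  checkPairs A? b = allColumns λ p → allColumns λ x → b p x ∨ not (isYes (A? p x))

  checkTriples : {A : Column m → Column m → Column m → Set} → (∀ p x q → Dec (A p x q)) →
                 (Column m → Column m → Column m → Bool) → Bool
  checkTriples A? b = allColumns λ p → checkPairs (A? p) (b p)

  checkPairs-sound : ∀ {A : Column m → Column m → Set} (A? : ∀ p x → Dec (A p x)) b → checkPairs A? b ≡ true →
                     ∀ {p x} → A p x → T (b p x)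
  checkPairs-sound A? b eq {p} {x} =
    T-∨-not (A? p x) (allColumns-sound (allColumns-sound (Equivalence.from T-≡ eq) p) x)

  checkTriples-sound : ∀ {A : Column m → Column m → Column m → Set} (A? : ∀ p x q → Dec (A p x q)) b →
                       checkTriples A? b ≡ true → ∀ {p x q} → A p x q → T (b p x q)
  checkTriples-sound A? b eq {p} {x} {q} =
    T-∨-not (A? p x q) (allColumns-sound (allColumns-sound (allColumns-sound (Equivalence.from T-≡ eq) p) x) q)

code : ∀ {m} → Column m → Fin (2 ^ m)
code []                  = zero
code {suc m} (false ∷ x) = code x ↑ˡ (2 ^ m + 0)
code {suc m} (true ∷ x)  = 2 ^ m ↑ʳ (code x ↑ˡ 0)

-- Row code p, entry code x of the table, where code reads a column from the top down as a binary numeral;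
-- 100 marks pairs that never occur as consecutive columns of a valid sequence.
potential : Column 4 → Column 4 → ℕ
potential p x = lookup (lookup table (code p)) (code x)
  where
  table : Vec (Vec ℕ 16) 16
  table =
    (100 ∷ 100 ∷ 100 ∷ 100 ∷ 100 ∷ 100 ∷ 100 ∷ 100 ∷ 100 ∷ 100 ∷ 100 ∷ 100 ∷ 100 ∷ 100 ∷ 100 ∷  15 ∷ []) ∷
    (100 ∷ 100 ∷ 100 ∷ 100 ∷ 100 ∷ 100 ∷ 100 ∷ 100 ∷ 100 ∷ 100 ∷ 100 ∷ 100 ∷   7 ∷  11 ∷  10 ∷  14 ∷ []) ∷
    (100 ∷ 100 ∷ 100 ∷ 100 ∷ 100 ∷ 100 ∷ 100 ∷ 100 ∷   3 ∷   7 ∷   7 ∷  11 ∷   5 ∷   9 ∷   9 ∷  13 ∷ []) ∷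
    (100 ∷ 100 ∷ 100 ∷ 100 ∷ 100 ∷ 100 ∷ 100 ∷ 100 ∷   5 ∷   9 ∷   9 ∷  13 ∷   8 ∷  12 ∷  12 ∷  16 ∷ []) ∷
    (100 ∷   3 ∷ 100 ∷   5 ∷ 100 ∷   7 ∷ 100 ∷   9 ∷ 100 ∷   7 ∷ 100 ∷   9 ∷ 100 ∷  11 ∷ 100 ∷  13 ∷ []) ∷
    (  0 ∷   4 ∷   4 ∷   8 ∷   4 ∷   8 ∷   8 ∷  12 ∷   4 ∷   8 ∷   8 ∷  12 ∷   8 ∷  12 ∷  12 ∷  16 ∷ []) ∷
    (  0 ∷   4 ∷   4 ∷   8 ∷   4 ∷   8 ∷   8 ∷  12 ∷   4 ∷   8 ∷   8 ∷  12 ∷   8 ∷  12 ∷  12 ∷  16 ∷ []) ∷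
    (  3 ∷   7 ∷   7 ∷  11 ∷   7 ∷  11 ∷  11 ∷  15 ∷   6 ∷  10 ∷  10 ∷  14 ∷  10 ∷  14 ∷  14 ∷  18 ∷ []) ∷
    (100 ∷ 100 ∷ 100 ∷   7 ∷ 100 ∷ 100 ∷ 100 ∷  10 ∷ 100 ∷ 100 ∷ 100 ∷  11 ∷ 100 ∷ 100 ∷ 100 ∷  14 ∷ []) ∷
    (  0 ∷   4 ∷   4 ∷   8 ∷   4 ∷   8 ∷   8 ∷  12 ∷   4 ∷   8 ∷   8 ∷  12 ∷   8 ∷  12 ∷  12 ∷  16 ∷ []) ∷
    (  0 ∷   4 ∷   4 ∷   8 ∷   4 ∷   8 ∷   8 ∷  12 ∷   4 ∷   8 ∷   8 ∷  12 ∷   8 ∷  12 ∷  12 ∷  16 ∷ []) ∷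
    (  2 ∷   6 ∷   6 ∷  10 ∷   6 ∷  10 ∷  10 ∷  14 ∷   6 ∷  10 ∷  10 ∷  14 ∷  10 ∷  14 ∷  14 ∷  18 ∷ []) ∷
    (100 ∷   5 ∷ 100 ∷   8 ∷ 100 ∷   9 ∷ 100 ∷  12 ∷ 100 ∷   9 ∷ 100 ∷  12 ∷ 100 ∷  13 ∷ 100 ∷  16 ∷ []) ∷
    (  2 ∷   6 ∷   6 ∷  10 ∷   6 ∷  10 ∷  10 ∷  14 ∷   6 ∷  10 ∷  10 ∷  14 ∷  10 ∷  14 ∷  14 ∷  18 ∷ []) ∷
    (  3 ∷   6 ∷   7 ∷  10 ∷   7 ∷  10 ∷  11 ∷  14 ∷   7 ∷  10 ∷  11 ∷  14 ∷  11 ∷  14 ∷  15 ∷  18 ∷ []) ∷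
    (  6 ∷  10 ∷  10 ∷  14 ∷  10 ∷  14 ∷  14 ∷  18 ∷  10 ∷  14 ∷  14 ∷  18 ∷  14 ∷  18 ∷  18 ∷  22 ∷ []) ∷
    []

potential-step : ∀ {p x q} → ColumnOK p x q → potential x q + 7 ≤ potential p x + 4 * weight q
potential-step = ≤ᵇ⇒≤ _ _ ∘ checkTriples-sound columnOK? holds checked
  where
  holds : Column 4 → Column 4 → Column 4 → Bool
  holds p x q = potential x q + 7 ≤ᵇ potential p x + 4 * weight q
  checked : checkTriples columnOK? holds ≡ true
  checked = refl

potential-final : ∀ {p x} → ColumnOK p x empty → 8 ≤ potential p x
potential-final = ≤ᵇ⇒≤ _ _ ∘ checkPairs-sound ends holds checked
  where
  ends : ∀ p x → Dec (ColumnOK p x empty)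
  ends p x = columnOK? p x empty
  holds : Column 4 → Column 4 → Bool
  holds p x = 8 ≤ᵇ potential p x
  checked : checkPairs ends holds ≡ true
  checked = refl

potential-initial : ∀ {x₀ x₁ x₂} → ColumnOK empty x₀ x₁ → ColumnOK x₀ x₁ x₂ →
                    potential x₁ x₂ + 3 * 7 ≤ 4 * (weight x₀ + weight x₁ + weight x₂) + 5
potential-initial ok₀ ok₁ = ≤ᵇ⇒≤ _ _ (checkTriples-sound starts holds checked (ok₀ , ok₁))
  where
  starts : ∀ x₀ x₁ x₂ → Dec (ColumnOK empty x₀ x₁ × ColumnOK x₀ x₁ x₂)
  starts x₀ x₁ x₂ = columnOK? empty x₀ x₁ ×-dec columnOK? x₀ x₁ x₂
  holds : Column 4 → Column 4 → Column 4 → Bool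
  holds x₀ x₁ x₂ = potential x₁ x₂ + 21 ≤ᵇ 4 * (weight x₀ + weight x₁ + weight x₂) + 5
  checked : checkTriples starts holds ≡ true
  checked = refl

ceil4-least : ∀ a s → a ≤ 4 * s → ceil4 a ≤ s
ceil4-least a s a≤4s = begin
  (a + 3) / 4      ≤⟨ /-monoˡ-≤ 4 (+-monoˡ-≤ 3 a≤4s) ⟩
  (4 * s + 3) / 4  ≡⟨ cong (λ z → (z + 3) / 4) (*-comm 4 s) ⟩
  (s * 4 + 3) / 4  ≡⟨ +-distrib-/-∣ˡ 3 (divides-refl s) ⟩
  s * 4 / 4 + 0    ≡⟨ cong (_+ 0) (m*n/n≡m s 4) ⟩
  s + 0            ≡⟨ +-identityʳ s ⟩
  s                ∎
  where open ≤-Reasoning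

ceil4-period : ∀ k → ceil4 (7 * (8 + k) + 3) ≡ 14 + ceil4 (7 * k + 3)
ceil4-period k = begin
  (7 * (8 + k) + 3 + 3) / 4  ≡⟨ cong (_/ 4) (solve 1 (λ k → con 7 :* (con 8 :+ k) :+ con 3 :+ con 3
                                                        := con 7 :* k :+ con 3 :+ con 3 :+ con 56) refl k) ⟩
  (7 * k + 3 + 3 + 56) / 4   ≡⟨ +-distrib-/-∣ʳ (7 * k + 3 + 3) (divides-refl 14) ⟩
  ceil4 (7 * k + 3) + 14     ≡⟨ +-comm _ 14 ⟩
  14 + ceil4 (7 * k + 3)     ∎
  where open ≡-Reasoning

module PotentialBound₄ = PotentialBound ColumnOK empty weight potential 7 4 8 5 potential-step potential-final potential-initial

γ₂-lower : ∀ r (D : VSet 4 (3 + r)) → IsTwoDominating D → ceil4 (7 * (3 + r) + 3) ≤ card D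
γ₂-lower r D dom = ceil4-least (7 * (3 + r) + 3) (card D) (+-cancelʳ-≤ 5 _ _ (begin
  7 * (3 + r) + 3 + 5                               ≡⟨ +-assoc (7 * (3 + r)) 3 5 ⟩
  7 * (3 + r) + 8                                   ≤⟨ PotentialBound₄.bound r (twoDominating⇒valid D dom) (column-beyond D ≤-refl) ⟩
  4 * ∑[ j < 3 + r ] weight (column D (toℕ j)) + 5  ≡⟨ cong (λ s → 4 * s + 5) (card≡∑weight D) ⟨
  4 * card D + 5                                    ∎))
  where open ≤-Reasoning

fromColumns : ∀ {m n} → Vec (Column m) n → VSet m n
fromColumns cs (i , j) = lookup (lookup cs j) i

module _ {m n : ℕ} (cs : Vec (Column m) n) where

  column-fromColumns : column (fromColumns cs) ≗ lookupOr empty cs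
  column-fromColumns k = by-cases (k <? n)
    where
    by-cases : Dec (k < n) → column (fromColumns cs) k ≡ lookupOr empty cs k
    by-cases (yes k<n) = begin
      column (fromColumns cs) k        ≡⟨ cong (column (fromColumns cs)) (toℕ-fromℕ< k<n) ⟨
      column (fromColumns cs) (toℕ j)  ≡⟨ tabulate-cong (λ i → extend-toℕ (fromColumns cs) i j) ⟩
      tabulate (lookup (lookup cs j))  ≡⟨ tabulate∘lookup (lookup cs j) ⟩
      lookup cs j                      ≡⟨ lookupOr-toℕ cs j ⟨
      lookupOr empty cs (toℕ j)        ≡⟨ cong (lookupOr empty cs) (toℕ-fromℕ< k<n) ⟩
      lookupOr empty cs k              ∎
      where
      open ≡-Reasoning
      j : Fin n
      j = fromℕ< k<n
    by-cases (no k≮n) = trans (column-beyond (fromColumns cs) (≮⇒≥ k≮n)) (sym (lookupOr-beyond cs (≮⇒≥ k≮n)))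

  card-fromColumns : card (fromColumns cs) ≡ ∑[ j < n ] weight (lookup cs j)
  card-fromColumns = trans (card≡∑weight (fromColumns cs))
    (sum-cong-≗ λ j → cong weight (trans (column-fromColumns (toℕ j)) (lookupOr-toℕ cs j)))

open Sequences (ColumnOK {4})
open Checked columnOK? empty

-- col abcd is the column whose rows carry the digits a, b, c, d from top to bottom.
col : ℕ → Column 4
col d = digit (d / 1000) ∷ digit (d / 100) ∷ digit (d / 10) ∷ digit d ∷ []
  where
  digit : ℕ → Bool
  digit k = k % 10 ≡ᵇ 1

period : Vec (Column 4) 8
period = col 1011 ∷ col 0100 ∷ col 1001 ∷ col 0010 ∷ col 1101 ∷ col 0010 ∷ col 1001 ∷ col 0100 ∷ []

ending : ∀ k → Vec (Column 4) (suc k)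
ending 0 = col 1011 ∷ []
ending 1 = col 1011 ∷ col 1010 ∷ []
ending 2 = col 1011 ∷ col 1000 ∷ col 0111 ∷ []
ending 3 = col 1011 ∷ col 0100 ∷ col 1001 ∷ col 1010 ∷ []
ending 4 = col 0111 ∷ col 1000 ∷ col 0011 ∷ col 1100 ∷ col 0101 ∷ []
ending 5 = col 1011 ∷ col 1000 ∷ col 0111 ∷ col 0100 ∷ col 1001 ∷ col 1010 ∷ []
ending 6 = col 1011 ∷ col 1000 ∷ col 0111 ∷ col 1000 ∷ col 0011 ∷ col 1100 ∷ col 0101 ∷ []
ending 7 = col 1011 ∷ col 0100 ∷ col 1001 ∷ col 0010 ∷ col 1101 ∷ col 0010 ∷ col 1001 ∷ col 0110 ∷ []
ending (suc (suc (suc (suc (suc (suc (suc (suc k)))))))) = period ++ ending k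

optimal : ∀ k → Vec (Column 4) (3 + k)
optimal zero    = col 0101 ∷ col 1010 ∷ col 0101 ∷ []
optimal (suc k) = col 1010 ∷ col 1001 ∷ col 0100 ∷ ending k

ending-chain : ∀ k → T (chainᵇ (col 1001) (col 0100 ∷ ending k))
ending-chain 0 = tt
ending-chain 1 = tt
ending-chain 2 = tt
ending-chain 3 = tt
ending-chain 4 = tt
ending-chain 5 = tt
ending-chain 6 = tt
ending-chain 7 = tt
ending-chain (suc (suc (suc (suc (suc (suc (suc (suc k)))))))) = ending-chain k

optimal-chain : ∀ k → T (chainᵇ empty (optimal k))
optimal-chain zero    = tt
optimal-chain (suc k) = ending-chain k

ending-weight : ∀ k → 5 + ∑[ j < suc k ] weight (lookup (ending k) j) ≡ ceil4 (7 * (4 + k) + 3)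
ending-weight 0 = refl
ending-weight 1 = refl
ending-weight 2 = refl
ending-weight 3 = refl
ending-weight 4 = refl
ending-weight 5 = refl
ending-weight 6 = refl
ending-weight 7 = refl
ending-weight (suc (suc (suc (suc (suc (suc (suc (suc k)))))))) =
  trans (cong (14 +_) (ending-weight k)) (sym (ceil4-period (4 + k)))

optimal-weight : ∀ k → ∑[ j < 3 + k ] weight (lookup (optimal k) j) ≡ ceil4 (7 * (3 + k) + 3)
optimal-weight zero    = refl
optimal-weight (suc k) = ending-weight k

γ₂-upper : ∀ k → Σ (VSet 4 (3 + k)) λ D → IsTwoDominating D × card D ≡ ceil4 (7 * (3 + k) + 3)
γ₂-upper k = D , valid⇒twoDominating D valid , trans (card-fromColumns (optimal k)) (optimal-weight k)
  where
  D : VSet 4 (3 + k)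
  D = fromColumns (optimal k)
  valid : ValidFrom empty (column D) (3 + k)
  valid = valid-cong (sym ∘ column-fromColumns (optimal k)) (chainᵇ-sound (optimal k) (optimal-chain k))

theorem4 : (n : ℕ) → 3 ≤ n → TwoDominationNumber 4 n (ceil4 (7 * n + 3))
theorem4 _ (s≤s (s≤s (s≤s {n = k} _))) = γ₂-upper k , γ₂-lower k
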